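{- Let $T$ be a standard Young tableau with three rows. The resolved $\mathsf{m}$-diagram of $T$ has no interior face with exactly four edges on its boundary.
   Context: Tableau conventions: rows are left-justified and numbered from the bottom; a standard Young tableau with $N$ boxes is a filling by $1,\dots,N$, each once, increasing left to right along rows and bottom to top along columns. $\mathsf{m}$-diagram: place points $1,\dots,N$ in order on a horizontal line $\ell$; for $i=1,\dots,N$ in increasing order, if $i$ lies in row $r+1$ ($r\ge 1$), join $i$ by an arc (upper semicircle with diameter $[j,i]$) to the largest entry $j<i$ of row $r$ not already joined by an arc to an entry of row $r+1$. First arcs join rows 1 and 2, second arcs rows 2 and 3. An $\mathsf{m}$ is a triple $i<j<k$ with arcs $(i,j),(j,k)$ and no other arcs at $i,j,k$; an isolated arc is an arc which is the only arc at either of its endpoints. Resolved $\mathsf{m}$-diagram: (1) for each $\mathsf{m}$ $(i,j,k)$ the two arcs meet at a trivalent interior vertex just above $j$, joined to boundary point $j$ by a short edge; (2) edges of each $\mathsf{m}$ are directed away from the boundary toward that trivalent vertex (arcs keep their direction through crossings), and isolated arcs are directed from the row-1 endpoint to the row-2 endpoint; (3) each crossing point of two arcs (two incoming, two outgoing half-edges) is replaced by two trivalent vertices joined by a new edge, one incident to the two incoming half-edges, the other to the two outgoing, the new edge directed from the latter to the former. An interior face is a face of this planar graph whose closure does not meet $\ell$. -}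

module Defs where

open import Data.Bool.Base using (Bool; true; false; if_then_else_; _∧_; _∨_; not)
open import Data.Nat.Base using (ℕ; zero; suc; _+_; _*_; _∸_; _≤_; _<_; _<ᵇ_; _≡ᵇ_)
open import Data.Bool.ListAction using (any)
open import Data.List.Base using (List; []; _∷_; _++_; length; map; filterᵇ; foldl; foldr; concatMap; take; upTo; applyUpTo)
open import Data.List.Relation.Unary.Linked using (Linked)
open import Data.List.Relation.Binary.Pointwise using (Pointwise)
open import Data.List.Relation.Binary.Permutation.Propositional using (_↭_)
open import Data.List.Relation.Unary.Unique.Propositional using (Unique)
open import Data.List.Membership.Propositional using (_∈_)
open import Data.Maybe.Base using (Maybe; just; nothing)
open import Data.Product.Base using (_×_; _,_; proj₁; proj₂; ∃; ∃-syntax)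
open import Relation.Binary.PropositionalEquality using (_≡_; _≢_)
open import Function.Bundles using (_⇔_)
open import Relation.Nullary using (¬_)

-- Standard Young tableaux with three rows.
-- A tableau is given by its three rows r₁ r₂ r₃ (row 1 = bottom row),
-- each listed left to right (rows are left-justified).

record IsSYT3 (r₁ r₂ r₃ : List ℕ) : Set where
  field
    shape₁₂   : length r₂ ≤ length r₁
    shape₂₃   : length r₃ ≤ length r₂
    threeRows : 1 ≤ length r₃
    row₁      : Linked _<_ r₁
    row₂      : Linked _<_ r₂
    row₃      : Linked _<_ r₃
    col₁₂     : Pointwise _<_ (take (length r₂) r₁) r₂
    col₂₃     : Pointwise _<_ (take (length r₃) r₂) r₃
    entries   : (r₁ ++ r₂ ++ r₃) ↭ applyUpTo suc (length r₁ + length r₂ + length r₃)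

-- an arc (j , i) with j < i joins boundary points j and i
Arc : Set
Arc = ℕ × ℕ

elemᵇ : ℕ → List ℕ → Bool
elemᵇ x = any (λ y → y ≡ᵇ x)

maxM : List ℕ → Maybe ℕ
maxM []       = nothing
maxM (x ∷ xs) with maxM xs
... | nothing = just x
... | just m  = just (if m <ᵇ x then x else m)

-- first arcs (rows 1–2) and second arcs (rows 2–3)
record MDiagram : Set where
  constructor mdiag
  field
    firsts  : List Arc
    seconds : List Arc
open MDiagram public

module _ (r₁ r₂ r₃ : List ℕ) where

  mstep : MDiagram → ℕ → MDiagram
  mstep (mdiag fs ss) i =
    if elemᵇ i r₂
      then (case₂ (maxM (filterᵇ (λ j → (j <ᵇ i) ∧ not (elemᵇ j (map proj₁ fs))) r₁)))
      else (if elemᵇ i r₃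
        then case₃ (maxM (filterᵇ (λ j → (j <ᵇ i) ∧ not (elemᵇ j (map proj₁ ss))) r₂))
        else mdiag fs ss)
    where
    case₂ : Maybe ℕ → MDiagram
    case₂ nothing  = mdiag fs ss
    case₂ (just j) = mdiag (fs ++ ((j , i) ∷ [])) ss
    case₃ : Maybe ℕ → MDiagram
    case₃ nothing  = mdiag fs ss
    case₃ (just j) = mdiag fs (ss ++ ((j , i) ∷ []))

  mDiagram : MDiagram
  mDiagram = foldl mstep (mdiag [] []) (applyUpTo suc (length r₁ + length r₂ + length r₃))

-- the upper semicircles on [a,b] and [c,d] cross iff the endpoints interleave
crossesᵇ : Arc → Arc → Bool
crossesᵇ (a , b) (c , d) = ((a <ᵇ c) ∧ (c <ᵇ b) ∧ (b <ᵇ d)) ∨ ((c <ᵇ a) ∧ (a <ᵇ d) ∧ (d <ᵇ b))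

absDiff : ℕ → ℕ → ℕ
absDiff m n = (m ∸ n) + (n ∸ m)

-- x-coordinate of the crossing point of the semicircles on [a,b] and [c,d]
-- is  |ab − cd| / |(a+b) − (c+d)|  (numerator , denominator)
xNum xDen : Arc → Arc → ℕ
xNum (a , b) (c , d) = absDiff (a * b) (c * d)
xDen (a , b) (c , d) = absDiff (a + b) (c + d)

xLessᵇ : Arc → Arc → Arc → Bool
xLessᵇ A X Y = (xNum A X * xDen A Y) <ᵇ (xNum A Y * xDen A X)

insertBy : {A : Set} → (A → A → Bool) → A → List A → List A
insertBy lt x []       = x ∷ []
insertBy lt x (y ∷ ys) = if lt y x then y ∷ insertBy lt x ys else x ∷ y ∷ ys

sortBy : {A : Set} → (A → A → Bool) → List A → List A
sortBy lt = foldr (insertBy lt) []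

eqArcᵇ : Arc → Arc → Bool
eqArcᵇ (a , b) (c , d) = (a ≡ᵇ c) ∧ (b ≡ᵇ d)

nthOr : {A : Set} → A → List A → ℕ → A
nthOr d []       _       = d
nthOr d (x ∷ xs) zero    = x
nthOr d (x ∷ xs) (suc n) = nthOr d xs n

indexOf : Arc → List Arc → ℕ
indexOf x []       = 0
indexOf x (y ∷ ys) = if eqArcᵇ x y then 0 else suc (indexOf x ys)

findOr : {A : Set} → A → (A → Bool) → List A → A
findOr d p []       = d
findOr d p (x ∷ xs) = if p x then x else findOr d p xs

-- The resolved m-diagram as a combinatorial map (rotation system).
--
-- A first arc F = (a , b) is directed from a to b (towards the
-- trivalent vertex above b if b is the middle of an m); a second arc
-- S = (c , d) is directed from d to c.  Along its direction an arc meets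
-- its crossings c₀ , … , c_{n-1} in order; each crossing is resolved into an
-- "in" vertex and an "out" vertex, so the arc is cut into pieces
-- 0 , … , n  (piece 0 starts at the boundary, piece p ends at the in-vertex of
-- crossing p, piece p+1 starts at its out-vertex, piece n ends at the end
-- of the arc).

data Edge : Set where
  piece₁ : Arc → ℕ → Edge
  piece₂ : Arc → ℕ → Edge
  short  : ℕ → Edge                -- edge from boundary point j to the trivalent vertex of the m with middle j
  bridge : Arc → Arc → Edge        -- new edge (out-vertex → in-vertex) at the crossing of first arc F and second arc S

data Node : Set where
  bd   : ℕ → Node
  mid  : ℕ → Node                  -- trivalent vertex just above j of the m with middle j
  cin  : Arc → Arc → Node          -- vertex incident to the two incoming half-edges at crossing (F , S)
  cout : Arc → Arc → Node          -- vertex incident to the two outgoing half-edges at crossing (F , S)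

-- a dart = an edge with a direction (true = along the edge's direction)
Dart : Set
Dart = Edge × Bool

module Resolved (D : MDiagram) where

  dflt : Arc
  dflt = (0 , 0)

  -- second arcs crossing F, in order along F (increasing x)
  cr₁ : Arc → List Arc
  cr₁ F = sortBy (xLessᵇ F) (filterᵇ (crossesᵇ F) (seconds D))

  -- first arcs crossing S, in order along S (decreasing x)
  cr₂ : Arc → List Arc
  cr₂ S = sortBy (λ X Y → xLessᵇ S Y X) (filterᵇ (λ F → crossesᵇ F S) (firsts D))

  -- j is the middle of an m  (iff some second arc starts at j)
  isMidᵇ : ℕ → Bool
  isMidᵇ j = any (λ S → proj₁ S ≡ᵇ j) (seconds D)

  firstInto : ℕ → Arc
  firstInto j = findOr dflt (λ F → proj₂ F ≡ᵇ j) (firsts D)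
  secondFrom : ℕ → Arc
  secondFrom j = findOr dflt (λ S → proj₁ S ≡ᵇ j) (seconds D)

  -- case 1 of a crossing (F left of S, i.e. a < c) versus case 2 (c < a)
  case1ᵇ : Arc → Arc → Bool
  case1ᵇ F S = proj₁ F <ᵇ proj₁ S

  edges : List Edge
  edges =
       concatMap (λ F → applyUpTo (piece₁ F) (suc (length (cr₁ F)))) (firsts D)
    ++ concatMap (λ S → applyUpTo (piece₂ S) (suc (length (cr₂ S)))) (seconds D)
    ++ map (λ S → short (proj₁ S)) (seconds D)
    ++ concatMap (λ F → map (bridge F) (cr₁ F)) (firsts D)

  darts : List Dart
  darts = concatMap (λ e → (e , true) ∷ (e , false) ∷ []) edges

  head : Edge → Node
  tail : Edge → Node
  tail (piece₁ F zero)    = bd (proj₁ F)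
  tail (piece₁ F (suc p)) = cout F (nthOr dflt (cr₁ F) p)
  tail (piece₂ S zero)    = bd (proj₂ S)
  tail (piece₂ S (suc p)) = cout (nthOr dflt (cr₂ S) p) S
  tail (short j)          = bd j
  tail (bridge F S)       = cout F S
  head (piece₁ F p) =
    if p <ᵇ length (cr₁ F) then cin F (nthOr dflt (cr₁ F) p)
    else (if isMidᵇ (proj₂ F) then mid (proj₂ F) else bd (proj₂ F))
  head (piece₂ S p) =
    if p <ᵇ length (cr₂ S) then cin (nthOr dflt (cr₂ S) p) S else mid (proj₁ S)
  head (short j)    = mid j
  head (bridge F S) = cin F S

  dtail : Dart → Node
  dtail (e , true)  = tail e
  dtail (e , false) = head e

  θ : Dart → Dart
  θ (e , b) = (e , not b)

  -- rotation: the next dart counterclockwise around the vertex dtail d.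
  -- Counterclockwise cyclic orders (from the planar picture):
  --   boundary point (degree 1) : [ d ]
  --   mid j        : [ S-end , F-end , short ]
  --   cin  F S     : case 1 [ S_in , F_in , e ]   case 2 [ F_in , S_in , e ]
  --   cout F S     : case 1 [ S_out , F_out , e' ] case 2 [ F_out , S_out , e' ]
  -- where the in-half-edges are the ends of the arc pieces arriving at the
  -- crossing, the out-half-edges the starts of the pieces leaving it, and
  -- e , e' the two ends of the bridge.
  σ : Dart → Dart
  σ (piece₁ F zero , true) = (piece₁ F zero , true)
  σ (piece₁ F (suc q) , true) =
    let S = nthOr dflt (cr₁ F) q in
    if case1ᵇ F S then (bridge F S , true)
    else (piece₂ S (suc (indexOf F (cr₂ S))) , true)
  σ (piece₁ F p , false) =
    if p <ᵇ length (cr₁ F)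
      then (let S = nthOr dflt (cr₁ F) p in
            if case1ᵇ F S then (bridge F S , false)
            else (piece₂ S (indexOf F (cr₂ S)) , false))
      else (if isMidᵇ (proj₂ F) then (short (proj₂ F) , false) else (piece₁ F p , false))
  σ (piece₂ S zero , true) = (piece₂ S zero , true)
  σ (piece₂ S (suc q) , true) =
    let F = nthOr dflt (cr₂ S) q in
    if case1ᵇ F S then (piece₁ F (suc (indexOf S (cr₁ F))) , true)
    else (bridge F S , true)
  σ (piece₂ S p , false) =
    if p <ᵇ length (cr₂ S)
      then (let F = nthOr dflt (cr₂ S) p in
            if case1ᵇ F S then (piece₁ F (indexOf S (cr₁ F)) , false)
            else (bridge F S , false))
      else (let F = firstInto (proj₁ S) in (piece₁ F (length (cr₁ F)) , false))
  σ (short j , true)  = (short j , true)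
  σ (short j , false) = let S = secondFrom j in (piece₂ S (length (cr₂ S)) , false)
  σ (bridge F S , true) =
    if case1ᵇ F S then (piece₂ S (suc (indexOf F (cr₂ S))) , true)
    else (piece₁ F (suc (indexOf S (cr₁ F))) , true)
  σ (bridge F S , false) =
    if case1ᵇ F S then (piece₂ S (indexOf F (cr₂ S)) , false)
    else (piece₁ F (indexOf S (cr₁ F)) , false)

  -- face-tracing permutation: faces are the orbits of φ = σ ∘ θ
  φ : Dart → Dart
  φ d = σ (θ d)

  iter : ℕ → Dart → Dart
  iter zero    d = d
  iter (suc k) d = φ (iter k d)

  record IsFace (d : Dart) (n : ℕ) : Set where
    field
      inGraph : d ∈ darts
      pos     : 1 ≤ n
      closes  : iter n d ≡ d
      minimal : ∀ k → 1 ≤ k → k < n → iter k d ≢ d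

  isBoundary : Node → Set
  isBoundary v = ∃[ j ] (v ≡ bd j)

  Interior : Dart → ℕ → Set
  Interior d n = ∀ k → k < n → ¬ isBoundary (dtail (iter k d))

  BoundaryEdges : Dart → ℕ → List Edge → Set
  BoundaryEdges d n es = Unique es × (∀ e → e ∈ es ⇔ (∃[ k ] (k < n × proj₁ (iter k d) ≡ e)))

  HasInteriorSquare : Set
  HasInteriorSquare =
    ∃[ d ] ∃[ n ] (IsFace d n × Interior d n × ∃[ es ] (length es ≡ 4 × BoundaryEdges d n es))

resolvedHasInteriorSquare : List ℕ → List ℕ → List ℕ → Set
resolvedHasInteriorSquare r₁ r₂ r₃ = Resolved.HasInteriorSquare (mDiagram r₁ r₂ r₃)

module Submission where

-- We show
-- that an interior face has at least five distinct edges.  The argument only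
-- uses that the m-diagram is well formed (no arc is listed twice, first arcs
-- run from left to right), which holds for the diagram built from any three
-- rows.
--
-- Each step flips the direction bit and changes the edge;
--    comparing left end points of crossing arcs rules out Step-cycles of
--    length 2 and 4 and returns to the reversed dart after 3 steps, so along
--    a trail no edge recurs within four steps.
-- 4. Interior: in a well-formed diagram consecutive darts of a face avoiding
--    ℓ are related by Step.  A face of length at most 4 would repeat its first
--    edge; a longer one has five distinct edges among its first five darts,
--    which do not fit into four (pigeonhole).

open import Defs
open import Data.Bool.Base using (Bool; true; false; not; T; _∧_)
open import Relation.Nullary.Decidable using (T?)
open import Function.Base using (_∘_; case_of_)
open import Data.Bool.Properties using (not-involutive; T-≡; T-∧; T-∨)
open import Data.Empty using (⊥; ⊥-elim)
open import Data.List.Base using (List; []; _∷_; _++_; length; map; concatMap; filterᵇ; foldl; applyUpTo; lookup)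
open import Data.List.Membership.Propositional using (_∈_)
open import Data.List.Membership.Propositional.Properties using (∈-filter⁻; ∈-filter⁺; ∈-++⁻)
open import Data.List.Relation.Binary.Permutation.Propositional
  using (_↭_; ↭-refl; ↭-prep; ↭-swap; ↭-trans; ↭-sym; ↭⇒↭ₛ)
open import Data.List.Relation.Binary.Permutation.Propositional.Properties using (∈-resp-↭)
open import Data.List.Relation.Unary.All as All using (All; _∷_; [])
open import Data.List.Relation.Unary.All.Properties using (++⁺; concat⁺; map⁺; applyUpTo⁺₁)
open import Data.List.Relation.Unary.AllPairs using (_∷_; [])
open import Data.List.Relation.Unary.Any using (here; there; index)
open import Data.List.Relation.Unary.Any.Properties using (lookup-index)
open import Data.List.Relation.Unary.Unique.Propositional using (Unique)
import Data.List.Relation.Unary.Unique.Propositional.Properties as Unique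
open import Data.Maybe.Base using (just; nothing)
open import Data.Nat.Base
  using (ℕ; zero; suc; _+_; _*_; _∸_; _≤_; _<_; _<ᵇ_; _≡ᵇ_; s≤s; z≤n; NonZero; >-nonZero)
open import Data.Nat.Properties
  using ( ≡ᵇ⇒≡; ≡⇒≡ᵇ; <ᵇ⇒<; <⇒<ᵇ; ≮⇒≥; ≰⇒>; _≤?_; ≤-refl; ≤-trans; ≤-antisym; ≤-<-trans
        ; <-irrefl; <-asym; <-trans; <-≤-trans; <⇒≤; <⇒≱; n<1+n; n≤1+n; m≤n⇒m≤1+n; 1+n≢n
        ; m≤n+m; m∸n+n≡m; m+n∸m≡n; m<n⇒0<n∸m; ∸-monoˡ-≤)
open import Data.Nat.DivMod using (_%_; _/_; m%n<n; m≡m%n+[m/n]*n)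
open import Data.Product.Base using (_×_; _,_; proj₁; proj₂; ∃₂)
open import Data.Sum.Base using (_⊎_; inj₁; inj₂)
open import Data.Unit.Base using (⊤; tt)
open import Data.Fin.Base using (toℕ)
open import Data.Fin.Properties using (pigeonhole; toℕ≤pred[n])
open import Function.Bundles using (Equivalence)
open import Relation.Binary.PropositionalEquality
  using (_≡_; _≢_; refl; sym; trans; cong; cong₂; subst; setoid; module ≡-Reasoning)
open import Relation.Nullary using (¬_; contradiction; yes; no)

module _ {A : Set} where

  insertBy-↭ : (lt : A → A → Bool) (x : A) (ys : List A) → insertBy lt x ys ↭ x ∷ ys
  insertBy-↭ lt x []       = ↭-refl
  insertBy-↭ lt x (y ∷ ys) with lt y x
  ... | true  = ↭-trans (↭-prep y (insertBy-↭ lt x ys)) (↭-swap y x ↭-refl)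
  ... | false = ↭-refl

  sortBy-↭ : (lt : A → A → Bool) (xs : List A) → sortBy lt xs ↭ xs
  sortBy-↭ lt []       = ↭-refl
  sortBy-↭ lt (x ∷ xs) = ↭-trans (insertBy-↭ lt x (sortBy lt xs)) (↭-prep x (sortBy-↭ lt xs))

  ∈-sortBy⁻ : (lt : A → A → Bool) {y : A} {xs : List A} → y ∈ sortBy lt xs → y ∈ xs
  ∈-sortBy⁻ lt {xs = xs} = ∈-resp-↭ (sortBy-↭ lt xs)

  ∈-sortBy⁺ : (lt : A → A → Bool) {y : A} {xs : List A} → y ∈ xs → y ∈ sortBy lt xs
  ∈-sortBy⁺ lt {xs = xs} = ∈-resp-↭ (↭-sym (sortBy-↭ lt xs))

  Unique-sortBy : (lt : A → A → Bool) {xs : List A} → Unique xs → Unique (sortBy lt xs)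
  Unique-sortBy lt {xs} = Unique-resp-↭ (↭⇒↭ₛ (↭-sym (sortBy-↭ lt xs)))
    where open import Data.List.Relation.Binary.Permutation.Setoid.Properties (setoid A) using (Unique-resp-↭)

  nthOr-∈ : (d : A) (xs : List A) {k : ℕ} → k < length xs → nthOr d xs k ∈ xs
  nthOr-∈ d (x ∷ xs) {zero}  _         = here refl
  nthOr-∈ d (x ∷ xs) {suc k} (s≤s k<) = there (nthOr-∈ d xs k<)

  nthOr-injective : (d : A) {xs : List A} → Unique xs → {i j : ℕ} → i < length xs → j < length xs
                  → nthOr d xs i ≡ nthOr d xs j → i ≡ j
  nthOr-injective d {x ∷ xs} _ {zero} {zero} _ _ _ = refl
  nthOr-injective d {x ∷ xs} (x≢ ∷ _) {zero} {suc j} _ (s≤s j<) eq =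
    contradiction eq (All.lookup x≢ (nthOr-∈ d xs j<))
  nthOr-injective d {x ∷ xs} (x≢ ∷ _) {suc i} {zero} (s≤s i<) _ eq =
    contradiction (sym eq) (All.lookup x≢ (nthOr-∈ d xs i<))
  nthOr-injective d {x ∷ xs} (_ ∷ u) {suc i} {suc j} (s≤s i<) (s≤s j<) eq =
    cong suc (nthOr-injective d u i< j< eq)

  findOr-spec : (d : A) (p : A → Bool) (xs : List A)
              → (findOr d p xs ∈ xs × T (p (findOr d p xs))) ⊎ findOr d p xs ≡ d
  findOr-spec d p []       = inj₂ refl
  findOr-spec d p (x ∷ xs) with p x in eq
  ... | true  = inj₁ (here refl , Equivalence.from T-≡ eq)
  ... | false with findOr-spec d p xs
  ...   | inj₁ (y∈ , py) = inj₁ (there y∈ , py)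
  ...   | inj₂ y≡d       = inj₂ y≡d

  pigeonhole-∈ : (xs : List A) (f : ℕ → A) → (∀ k → k ≤ length xs → f k ∈ xs)
               → ∃₂ λ i j → i < j × j ≤ length xs × f i ≡ f j
  pigeonhole-∈ xs f mem with pigeonhole (n<1+n (length xs)) (λ k → index (mem (toℕ k) (toℕ≤pred[n] k)))
  ... | i , j , i<j , same = toℕ i , toℕ j , i<j , toℕ≤pred[n] j ,
    trans (lookup-index (mem (toℕ i) (toℕ≤pred[n] i)))
          (trans (cong (lookup xs) same) (sym (lookup-index (mem (toℕ j) (toℕ≤pred[n] j)))))

concatMap-All : {A B : Set} {P : B → Set} (f : A → List B) {xs : List A}
              → (∀ {x} → x ∈ xs → All P (f x)) → All P (concatMap f xs)
concatMap-All f h = concat⁺ (map⁺ {f = f} (All.tabulate h))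

eqArcᵇ-sound : (x y : Arc) → T (eqArcᵇ x y) → x ≡ y
eqArcᵇ-sound (a , b) (c , d) t with Equivalence.to T-∧ t
... | ta , tb = cong₂ _,_ (≡ᵇ⇒≡ a c ta) (≡ᵇ⇒≡ b d tb)

eqArcᵇ-refl : (x : Arc) → T (eqArcᵇ x x)
eqArcᵇ-refl (a , b) = Equivalence.from T-∧ (≡⇒≡ᵇ a a refl , ≡⇒≡ᵇ b b refl)

indexOf-spec : (d x : Arc) (xs : List Arc) → x ∈ xs
             → indexOf x xs < length xs × nthOr d xs (indexOf x xs) ≡ x
indexOf-spec d x (y ∷ ys) x∈ with eqArcᵇ x y in eq
... | true  = s≤s z≤n , sym (eqArcᵇ-sound x y (Equivalence.from T-≡ eq))
... | false with x∈
...   | here refl = ⊥-elim (subst T eq (eqArcᵇ-refl x))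
...   | there x∈ys with indexOf-spec d x ys x∈ys
...     | i< , nth≡ = s≤s i< , nth≡

maxM-∈ : (xs : List ℕ) {m : ℕ} → maxM xs ≡ just m → m ∈ xs
maxM-∈ (x ∷ xs) eq with maxM xs in eq′
maxM-∈ (x ∷ xs) refl | nothing = here refl
maxM-∈ (x ∷ xs) eq   | just k with k <ᵇ x
maxM-∈ (x ∷ xs) refl | just k | true  = here refl
maxM-∈ (x ∷ xs) refl | just k | false = there (maxM-∈ xs eq′)

record WellFormed (D : MDiagram) : Set where
  field
    firsts-unique    : Unique (firsts D)
    seconds-unique   : Unique (seconds D)
    firsts-rightward : ∀ {F} → F ∈ firsts D → proj₁ F < proj₂ F

record Built (i : ℕ) (D : MDiagram) : Set where
  field
    wellFormed  : WellFormed D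
    firsts-end  : ∀ {F} → F ∈ firsts D → proj₂ F < i
    seconds-end : ∀ {S} → S ∈ seconds D → proj₂ S < i

maxM-filter : (p : ℕ → Bool) (xs : List ℕ) {m : ℕ} → maxM (filterᵇ p xs) ≡ just m → T (p m)
maxM-filter p xs eq = proj₂ (∈-filter⁻ (T? ∘ p) {xs = xs} (maxM-∈ (filterᵇ p xs) eq))

data StepEffect (D : MDiagram) (i : ℕ) : MDiagram → Set where
  unchanged : StepEffect D i D
  newFirst  : ∀ j → j < i → StepEffect D i (mdiag (firsts D ++ (j , i) ∷ []) (seconds D))
  newSecond : ∀ j → StepEffect D i (mdiag (firsts D) (seconds D ++ (j , i) ∷ []))

mstep-effect : (r₁ r₂ r₃ : List ℕ) (D : MDiagram) (i : ℕ) → StepEffect D i (mstep r₁ r₂ r₃ D i)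
mstep-effect r₁ r₂ r₃ (mdiag fs ss) i with elemᵇ i r₂
... | true with maxM (filterᵇ (λ j → (j <ᵇ i) ∧ not (elemᵇ j (map proj₁ fs))) r₁) in eq
...   | nothing = unchanged
...   | just j  = newFirst j (<ᵇ⇒< j i (proj₁ (Equivalence.to T-∧ picked)))
  where
  picked : T ((j <ᵇ i) ∧ not (elemᵇ j (map proj₁ fs)))
  picked = maxM-filter (λ j → (j <ᵇ i) ∧ not (elemᵇ j (map proj₁ fs))) r₁ eq
mstep-effect r₁ r₂ r₃ (mdiag fs ss) i | false with elemᵇ i r₃
... | false = unchanged
... | true with maxM (filterᵇ (λ j → (j <ᵇ i) ∧ not (elemᵇ j (map proj₁ ss))) r₂)
...   | nothing = unchanged
...   | just j  = newSecond j

snoc-unique : {xs : List Arc} {j i : ℕ} → Unique xs → (∀ {x} → x ∈ xs → proj₂ x < i)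
            → Unique (xs ++ (j , i) ∷ [])
snoc-unique u ends = Unique.++⁺ u ([] ∷ []) λ { (x∈ , here refl) → <-irrefl refl (ends x∈) }

snoc-ends : {xs : List Arc} {j i : ℕ} → (∀ {x} → x ∈ xs → proj₂ x < i)
          → ∀ {x} → x ∈ xs ++ (j , i) ∷ [] → proj₂ x < suc i
snoc-ends {xs} ends x∈ with ∈-++⁻ xs x∈
... | inj₁ x∈xs        = m≤n⇒m≤1+n (ends x∈xs)
... | inj₂ (here refl) = n<1+n _

Built-weaken : {i i′ : ℕ} {D : MDiagram} → i ≤ i′ → Built i D → Built i′ D
Built-weaken i≤i′ b = record
  { wellFormed  = wellFormed
  ; firsts-end  = λ F∈ → <-≤-trans (firsts-end F∈) i≤i′
  ; seconds-end = λ S∈ → <-≤-trans (seconds-end S∈) i≤i′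
  }
  where open Built b

Built-step : {i : ℕ} {D D′ : MDiagram} → Built i D → StepEffect D i D′ → Built (suc i) D′
Built-step b unchanged = Built-weaken (n≤1+n _) b
Built-step {i} {D} b (newFirst j j<i) = record
  { wellFormed  = record
    { firsts-unique    = snoc-unique (WellFormed.firsts-unique wellFormed) firsts-end
    ; seconds-unique   = WellFormed.seconds-unique wellFormed
    ; firsts-rightward = rightward
    }
  ; firsts-end  = snoc-ends firsts-end
  ; seconds-end = λ S∈ → m≤n⇒m≤1+n (seconds-end S∈)
  }
  where
  open Built b
  rightward : ∀ {F} → F ∈ firsts D ++ (j , i) ∷ [] → proj₁ F < proj₂ F
  rightward F∈ with ∈-++⁻ (firsts D) F∈
  ... | inj₁ F∈fs        = WellFormed.firsts-rightward wellFormed F∈fs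
  ... | inj₂ (here refl) = j<i
Built-step b (newSecond j) = record
  { wellFormed  = record
    { firsts-unique    = WellFormed.firsts-unique wellFormed
    ; seconds-unique   = snoc-unique (WellFormed.seconds-unique wellFormed) seconds-end
    ; firsts-rightward = WellFormed.firsts-rightward wellFormed
    }
  ; firsts-end  = λ F∈ → m≤n⇒m≤1+n (firsts-end F∈)
  ; seconds-end = snoc-ends seconds-end
  }
  where open Built b

Built-foldl : (r₁ r₂ r₃ : List ℕ) (n : ℕ) (f : ℕ → ℕ) (D : MDiagram) → (∀ x → f x < f (suc x))
            → Built (f 0) D → Built (f n) (foldl (mstep r₁ r₂ r₃) D (applyUpTo f n))
Built-foldl r₁ r₂ r₃ zero    f D inc b = b
Built-foldl r₁ r₂ r₃ (suc n) f D inc b =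
  Built-foldl r₁ r₂ r₃ n (λ x → f (suc x)) _ (λ x → inc (suc x))
    (Built-weaken (inc 0) (Built-step b (mstep-effect r₁ r₂ r₃ D (f 0))))

mDiagram-wellFormed : (r₁ r₂ r₃ : List ℕ) → WellFormed (mDiagram r₁ r₂ r₃)
mDiagram-wellFormed r₁ r₂ r₃ =
  Built.wellFormed
    (Built-foldl r₁ r₂ r₃ (length r₁ + length r₂ + length r₃) suc (mdiag [] []) (λ x → n<1+n (suc x)) empty)
  where
  empty : Built 1 (mdiag [] [])
  empty = record
    { wellFormed  = record { firsts-unique = [] ; seconds-unique = [] ; firsts-rightward = λ () }
    ; firsts-end  = λ ()
    ; seconds-end = λ ()
    }

module FaceTracing (D : MDiagram) where
  open Resolved D

  len₁ len₂ : Arc → ℕ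
  len₁ F = length (cr₁ F)
  len₂ S = length (cr₂ S)

  at₁ at₂ : Arc → ℕ → Arc
  at₁ F k = nthOr dflt (cr₁ F) k
  at₂ S k = nthOr dflt (cr₂ S) k

  iter-+ : ∀ a b d → iter (a + b) d ≡ iter a (iter b d)
  iter-+ zero    b d = refl
  iter-+ (suc a) b d = cong φ (iter-+ a b d)

  iter-mod : ∀ {d n} .{{_ : NonZero n}} → iter n d ≡ d → ∀ k → iter k d ≡ iter (k % n) d
  iter-mod {d} {n} closes k = begin
      iter k d                            ≡⟨ cong (λ m → iter m d) (m≡m%n+[m/n]*n k n) ⟩
      iter (k % n + (k / n) * n) d        ≡⟨ iter-+ (k % n) ((k / n) * n) d ⟩
      iter (k % n) (iter ((k / n) * n) d) ≡⟨ cong (iter (k % n)) (periodic (k / n)) ⟩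
      iter (k % n) d                      ∎
    where
    open ≡-Reasoning
    periodic : ∀ q → iter (q * n) d ≡ d
    periodic zero    = refl
    periodic (suc q) = trans (iter-+ n (q * n) d) (trans (cong (iter n) (periodic q)) closes)

  -- One step φ : d ↦ d′ of face tracing through an interior vertex, as read
  -- off the rotation system.  A constructor is named after the dart d: it runs
  -- forward (⁺) or backward (⁻) along a piece of a first arc (F), of a second
  -- arc (S) or along a bridge (B) into the vertex; the index says which arc
  -- starts further left at the crossing (F , S) there: ₁ if F does, ₂ if S does.
  -- S⁺mid is the step through the trivalent vertex of an m.
  data Step : Dart → Dart → Set where
    F⁺₁ : ∀ {F k S} → k < len₁ F → at₁ F k ≡ S → proj₁ F < proj₁ S
        → Step (piece₁ F k , true) (bridge F S , false)
    F⁺₂ : ∀ {F k S i} → k < len₁ F → at₁ F k ≡ S → proj₁ S ≤ proj₁ F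
        → i < len₂ S → at₂ S i ≡ F
        → Step (piece₁ F k , true) (piece₂ S i , false)
    F⁻₁ : ∀ {F j S} → j < len₁ F → at₁ F j ≡ S → proj₁ F < proj₁ S
        → proj₁ F < proj₂ F → T (crossesᵇ F S)
        → Step (piece₁ F (suc j) , false) (bridge F S , true)
    F⁻₂ : ∀ {F j S i} → j < len₁ F → at₁ F j ≡ S → proj₁ S ≤ proj₁ F
        → proj₁ F < proj₂ F → T (crossesᵇ F S) → i < len₂ S → at₂ S i ≡ F
        → Step (piece₁ F (suc j) , false) (piece₂ S (suc i) , true)
    S⁺₁ : ∀ {S k F j} → k < len₂ S → at₂ S k ≡ F → proj₁ F < proj₁ S
        → j < len₁ F → at₁ F j ≡ S
        → Step (piece₂ S k , true) (piece₁ F j , false)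
    S⁺₂ : ∀ {S k F} → k < len₂ S → at₂ S k ≡ F → proj₁ S ≤ proj₁ F
        → Step (piece₂ S k , true) (bridge F S , false)
    S⁺mid : ∀ {a b d k m} → k ≡ len₂ (b , d) → m ≡ len₁ (a , b)
          → Step (piece₂ (b , d) k , true) (piece₁ (a , b) m , false)
    S⁻₁ : ∀ {S i F j} → i < len₂ S → at₂ S i ≡ F → proj₁ F < proj₁ S
        → j < len₁ F → at₁ F j ≡ S
        → Step (piece₂ S (suc i) , false) (piece₁ F (suc j) , true)
    S⁻₂ : ∀ {S i F} → i < len₂ S → at₂ S i ≡ F → proj₁ S ≤ proj₁ F
        → Step (piece₂ S (suc i) , false) (bridge F S , true)
    B⁺₁ : ∀ {F S i} → proj₁ F < proj₁ S → i < len₂ S → at₂ S i ≡ F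
        → Step (bridge F S , true) (piece₂ S i , false)
    B⁺₂ : ∀ {F S j} → proj₁ S ≤ proj₁ F → j < len₁ F → at₁ F j ≡ S
        → Step (bridge F S , true) (piece₁ F j , false)
    B⁻₁ : ∀ {F S i} → proj₁ F < proj₁ S → i < len₂ S → at₂ S i ≡ F
        → Step (bridge F S , false) (piece₂ S (suc i) , true)
    B⁻₂ : ∀ {F S j} → proj₁ S ≤ proj₁ F → j < len₁ F → at₁ F j ≡ S
        → Step (bridge F S , false) (piece₁ F (suc j) , true)

  flips : ∀ {d d′} → Step d d′ → proj₂ d′ ≡ not (proj₂ d)
  flips (F⁺₁ _ _ _)         = refl
  flips (F⁺₂ _ _ _ _ _)     = refl
  flips (F⁻₁ _ _ _ _ _)     = refl
  flips (F⁻₂ _ _ _ _ _ _ _) = refl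
  flips (S⁺₁ _ _ _ _ _)     = refl
  flips (S⁺₂ _ _ _)         = refl
  flips (S⁺mid _ _)         = refl
  flips (S⁻₁ _ _ _ _ _)     = refl
  flips (S⁻₂ _ _ _)         = refl
  flips (B⁺₁ _ _ _)         = refl
  flips (B⁺₂ _ _ _)         = refl
  flips (B⁻₁ _ _ _)         = refl
  flips (B⁻₂ _ _ _)         = refl

  changes-edge : ∀ {d d′} → Step d d′ → proj₁ d ≢ proj₁ d′
  changes-edge (F⁺₁ _ _ _)         ()
  changes-edge (F⁺₂ _ _ _ _ _)     ()
  changes-edge (F⁻₁ _ _ _ _ _)     ()
  changes-edge (F⁻₂ _ _ _ _ _ _ _) ()
  changes-edge (S⁺₁ _ _ _ _ _)     ()
  changes-edge (S⁺₂ _ _ _)         ()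
  changes-edge (S⁺mid _ _)         ()
  changes-edge (S⁻₁ _ _ _ _ _)     ()
  changes-edge (S⁻₂ _ _ _)         ()
  changes-edge (B⁺₁ _ _ _)         ()
  changes-edge (B⁺₂ _ _ _)         ()
  changes-edge (B⁻₁ _ _ _)         ()
  changes-edge (B⁻₂ _ _ _)         ()

  flips-twice : ∀ {d d′ d″} → Step d d′ → Step d′ d″ → proj₂ d″ ≡ proj₂ d
  flips-twice s s′ = trans (flips s′) (trans (cong not (flips s)) (not-involutive _))

  nocross : ∀ {a b d} → a < b → T (crossesᵇ (a , b) (b , d)) → ⊥
  nocross {a} {b} {d} a<b t with Equivalence.to T-∨ t
  ... | inj₁ t₁ = <-irrefl refl (<ᵇ⇒< b b (proj₁ (Equivalence.to (T-∧ {b <ᵇ b}) b<b∧b<d)))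
    where
    b<b∧b<d : T ((b <ᵇ b) ∧ (b <ᵇ d))
    b<b∧b<d = proj₂ (Equivalence.to (T-∧ {a <ᵇ b}) t₁)
  ... | inj₂ t₂ = <-asym a<b (<ᵇ⇒< b a (proj₁ (Equivalence.to (T-∧ {b <ᵇ a}) t₂)))

  cyclic-chain : ∀ {a b c d} → a < b → b ≤ c → c < d → d ≤ a → ⊥
  cyclic-chain a<b b≤c c<d d≤a = <-irrefl refl (<-≤-trans (<-trans (<-≤-trans a<b b≤c) c<d) d≤a)

  -- No face has two darts: it would pass one crossing in both of its cases,
  -- or let a first arc cross the second arc starting at its own end point.
  no-2-cycle : ∀ {d₀ d₁} → Step d₀ d₁ → Step d₁ d₀ → ⊥
  no-2-cycle (F⁺₂ _ _ q _ _) (S⁻₁ _ _ p _ _) = <⇒≱ p q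
  no-2-cycle (S⁺₁ _ _ p _ _) (F⁻₂ _ _ q _ _ _ _) = <⇒≱ p q
  no-2-cycle (S⁺mid _ _) (F⁻₂ _ _ _ p q _ _) = nocross p q
  no-2-cycle (F⁻₂ _ _ q _ _ _ _) (S⁺₁ _ _ p _ _) = <⇒≱ p q
  no-2-cycle (F⁻₂ _ _ _ p q _ _) (S⁺mid _ _) = nocross p q
  no-2-cycle (S⁻₁ _ _ p _ _) (F⁺₂ _ _ q _ _) = <⇒≱ p q
  no-2-cycle (F⁺₁ _ _ p) (B⁻₂ q _ _) = <⇒≱ p q
  no-2-cycle (B⁻₂ q _ _) (F⁺₁ _ _ p) = <⇒≱ p q
  no-2-cycle (S⁺₂ _ _ q) (B⁻₁ p _ _) = <⇒≱ p q
  no-2-cycle (B⁻₁ p _ _) (S⁺₂ _ _ q) = <⇒≱ p q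
  no-2-cycle (B⁺₁ p _ _) (S⁻₂ _ _ q) = <⇒≱ p q
  no-2-cycle (S⁻₂ _ _ q) (B⁺₁ p _ _) = <⇒≱ p q
  no-2-cycle (B⁺₂ q _ _) (F⁻₁ _ _ p _ _) = <⇒≱ p q
  no-2-cycle (F⁻₁ _ _ p _ _) (B⁺₂ q _ _) = <⇒≱ p q

  -- No face has four darts: either some crossing is met in both of its cases,
  -- or the left end points of the four arcs involved increase around the cycle.
  no-4-cycle : ∀ {d₀ d₁ d₂ d₃} → Step d₀ d₁ → Step d₁ d₂ → Step d₂ d₃ → Step d₃ d₀ → ⊥
  no-4-cycle (F⁺₁ _ _ p) (B⁻₁ _ _ _) (S⁺₂ _ _ q) (B⁻₂ _ _ _) = <⇒≱ p q
  no-4-cycle (F⁺₁ _ _ p) (B⁻₂ q _ _) (F⁺₁ _ _ _) (B⁻₂ _ _ _) = <⇒≱ p q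
  no-4-cycle (F⁺₁ _ _ p) (B⁻₂ q _ _) (F⁺₂ _ _ _ _ _) (S⁻₁ _ _ _ _ _) = <⇒≱ p q
  no-4-cycle (F⁺₂ _ _ _ _ _) (S⁻₁ _ _ _ _ _) (F⁺₁ _ _ p) (B⁻₂ q _ _) = <⇒≱ p q
  no-4-cycle (F⁺₂ _ _ s _ _) (S⁻₁ _ _ r _ _) (F⁺₂ _ _ q _ _) (S⁻₁ _ _ p _ _) = cyclic-chain p q r s
  no-4-cycle (F⁺₂ _ _ _ _ _) (S⁻₂ _ _ q) (B⁺₁ p _ _) (S⁻₁ _ _ _ _ _) = <⇒≱ p q
  no-4-cycle (S⁺₁ _ _ _ _ _) (F⁻₁ _ _ p _ _) (B⁺₂ q _ _) (F⁻₂ _ _ _ _ _ _ _) = <⇒≱ p q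
  no-4-cycle (S⁺₁ _ _ p _ _) (F⁻₂ _ _ s _ _ _ _) (S⁺₁ _ _ r _ _) (F⁻₂ _ _ q _ _ _ _) = cyclic-chain p q r s
  no-4-cycle (S⁺₁ _ _ _ _ _) (F⁻₂ _ _ _ _ _ _ _) (S⁺₂ _ _ q) (B⁻₁ p _ _) = <⇒≱ p q
  no-4-cycle (S⁺₁ _ _ p _ _) (F⁻₂ _ _ s _ _ _ _) (S⁺mid _ _) (F⁻₂ _ _ q r _ _ _) = cyclic-chain p q r s
  no-4-cycle (S⁺₂ _ _ q) (B⁻₁ p _ _) (S⁺₁ _ _ _ _ _) (F⁻₂ _ _ _ _ _ _ _) = <⇒≱ p q
  no-4-cycle (S⁺₂ _ _ q) (B⁻₁ p _ _) (S⁺₂ _ _ _) (B⁻₁ _ _ _) = <⇒≱ p q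
  no-4-cycle (S⁺₂ _ _ q) (B⁻₁ p _ _) (S⁺mid _ _) (F⁻₂ _ _ _ _ _ _ _) = <⇒≱ p q
  no-4-cycle (S⁺₂ _ _ q) (B⁻₂ _ _ _) (F⁺₁ _ _ p) (B⁻₁ _ _ _) = <⇒≱ p q
  no-4-cycle (S⁺mid _ _) (F⁻₁ _ _ p _ _) (B⁺₂ q _ _) (F⁻₂ _ _ _ _ _ _ _) = <⇒≱ p q
  no-4-cycle (S⁺mid _ _) (F⁻₂ _ _ q r _ _ _) (S⁺₁ _ _ p _ _) (F⁻₂ _ _ s _ _ _ _) = cyclic-chain p q r s
  no-4-cycle (S⁺mid _ _) (F⁻₂ _ _ _ _ _ _ _) (S⁺₂ _ _ q) (B⁻₁ p _ _) = <⇒≱ p q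
  no-4-cycle (S⁺mid _ _) (F⁻₂ _ _ s p _ _ _) (S⁺mid _ _) (F⁻₂ _ _ q r _ _ _) = cyclic-chain p q r s
  no-4-cycle (B⁺₁ p _ _) (S⁻₁ _ _ _ _ _) (F⁺₂ _ _ _ _ _) (S⁻₂ _ _ q) = <⇒≱ p q
  no-4-cycle (B⁺₁ _ _ _) (S⁻₂ _ _ q) (B⁺₁ p _ _) (S⁻₂ _ _ _) = <⇒≱ p q
  no-4-cycle (B⁺₁ p _ _) (S⁻₂ _ _ q) (B⁺₂ _ _ _) (F⁻₁ _ _ _ _ _) = <⇒≱ p q
  no-4-cycle (B⁺₂ _ _ _) (F⁻₁ _ _ _ _ _) (B⁺₁ p _ _) (S⁻₂ _ _ q) = <⇒≱ p q
  no-4-cycle (B⁺₂ _ _ _) (F⁻₁ _ _ p _ _) (B⁺₂ q _ _) (F⁻₁ _ _ _ _ _) = <⇒≱ p q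
  no-4-cycle (B⁺₂ q _ _) (F⁻₂ _ _ _ _ _ _ _) (S⁺₁ _ _ _ _ _) (F⁻₁ _ _ p _ _) = <⇒≱ p q
  no-4-cycle (B⁺₂ q _ _) (F⁻₂ _ _ _ _ _ _ _) (S⁺mid _ _) (F⁻₁ _ _ p _ _) = <⇒≱ p q
  no-4-cycle (F⁻₁ _ _ _ _ _) (B⁺₁ p _ _) (S⁻₂ _ _ q) (B⁺₂ _ _ _) = <⇒≱ p q
  no-4-cycle (F⁻₁ _ _ p _ _) (B⁺₂ q _ _) (F⁻₁ _ _ _ _ _) (B⁺₂ _ _ _) = <⇒≱ p q
  no-4-cycle (F⁻₁ _ _ p _ _) (B⁺₂ q _ _) (F⁻₂ _ _ _ _ _ _ _) (S⁺₁ _ _ _ _ _) = <⇒≱ p q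
  no-4-cycle (F⁻₁ _ _ p _ _) (B⁺₂ q _ _) (F⁻₂ _ _ _ _ _ _ _) (S⁺mid _ _) = <⇒≱ p q
  no-4-cycle (F⁻₂ _ _ _ _ _ _ _) (S⁺₁ _ _ _ _ _) (F⁻₁ _ _ p _ _) (B⁺₂ q _ _) = <⇒≱ p q
  no-4-cycle (F⁻₂ _ _ q _ _ _ _) (S⁺₁ _ _ p _ _) (F⁻₂ _ _ s _ _ _ _) (S⁺₁ _ _ r _ _) = cyclic-chain p q r s
  no-4-cycle (F⁻₂ _ _ q r _ _ _) (S⁺₁ _ _ p _ _) (F⁻₂ _ _ s _ _ _ _) (S⁺mid _ _) = cyclic-chain p q r s
  no-4-cycle (F⁻₂ _ _ _ _ _ _ _) (S⁺₂ _ _ q) (B⁻₁ p _ _) (S⁺₁ _ _ _ _ _) = <⇒≱ p q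
  no-4-cycle (F⁻₂ _ _ _ _ _ _ _) (S⁺₂ _ _ q) (B⁻₁ p _ _) (S⁺mid _ _) = <⇒≱ p q
  no-4-cycle (F⁻₂ _ _ _ _ _ _ _) (S⁺mid _ _) (F⁻₁ _ _ p _ _) (B⁺₂ q _ _) = <⇒≱ p q
  no-4-cycle (F⁻₂ _ _ s _ _ _ _) (S⁺mid _ _) (F⁻₂ _ _ q r _ _ _) (S⁺₁ _ _ p _ _) = cyclic-chain p q r s
  no-4-cycle (F⁻₂ _ _ q r _ _ _) (S⁺mid _ _) (F⁻₂ _ _ s p _ _ _) (S⁺mid _ _) = cyclic-chain p q r s
  no-4-cycle (S⁻₁ _ _ _ _ _) (F⁺₁ _ _ p) (B⁻₂ q _ _) (F⁺₂ _ _ _ _ _) = <⇒≱ p q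
  no-4-cycle (S⁻₁ _ _ p _ _) (F⁺₂ _ _ s _ _) (S⁻₁ _ _ r _ _) (F⁺₂ _ _ q _ _) = cyclic-chain p q r s
  no-4-cycle (S⁻₁ _ _ _ _ _) (F⁺₂ _ _ _ _ _) (S⁻₂ _ _ q) (B⁺₁ p _ _) = <⇒≱ p q
  no-4-cycle (S⁻₂ _ _ q) (B⁺₁ p _ _) (S⁻₁ _ _ _ _ _) (F⁺₂ _ _ _ _ _) = <⇒≱ p q
  no-4-cycle (S⁻₂ _ _ q) (B⁺₁ p _ _) (S⁻₂ _ _ _) (B⁺₁ _ _ _) = <⇒≱ p q
  no-4-cycle (S⁻₂ _ _ q) (B⁺₂ _ _ _) (F⁻₁ _ _ _ _ _) (B⁺₁ p _ _) = <⇒≱ p q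
  no-4-cycle (B⁻₁ p _ _) (S⁺₁ _ _ _ _ _) (F⁻₂ _ _ _ _ _ _ _) (S⁺₂ _ _ q) = <⇒≱ p q
  no-4-cycle (B⁻₁ _ _ _) (S⁺₂ _ _ q) (B⁻₁ p _ _) (S⁺₂ _ _ _) = <⇒≱ p q
  no-4-cycle (B⁻₁ _ _ _) (S⁺₂ _ _ q) (B⁻₂ _ _ _) (F⁺₁ _ _ p) = <⇒≱ p q
  no-4-cycle (B⁻₁ p _ _) (S⁺mid _ _) (F⁻₂ _ _ _ _ _ _ _) (S⁺₂ _ _ q) = <⇒≱ p q
  no-4-cycle (B⁻₂ _ _ _) (F⁺₁ _ _ p) (B⁻₁ _ _ _) (S⁺₂ _ _ q) = <⇒≱ p q
  no-4-cycle (B⁻₂ _ _ _) (F⁺₁ _ _ p) (B⁻₂ q _ _) (F⁺₁ _ _ _) = <⇒≱ p q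
  no-4-cycle (B⁻₂ q _ _) (F⁺₂ _ _ _ _ _) (S⁻₁ _ _ _ _ _) (F⁺₁ _ _ p) = <⇒≱ p q

  Trail : (ℕ → Dart) → Set
  Trail x = ∀ k → Step (x k) (x (suc k))

  -- When no arc meets another arc twice, three steps never lead back to the
  -- reversed dart: that would put one crossing at two consecutive positions.
  module DistinctCrossings (cr₁-unique : ∀ F → Unique (cr₁ F)) (cr₂-unique : ∀ S → Unique (cr₂ S)) where

    repeats₁ : ∀ {F S i} → i < len₁ F → suc i < len₁ F → at₁ F i ≡ S → at₁ F (suc i) ≡ S → ⊥
    repeats₁ {F} i< si< e e′ = 1+n≢n (sym (nthOr-injective dflt (cr₁-unique F) i< si< (trans e (sym e′))))

    repeats₂ : ∀ {S F i} → i < len₂ S → suc i < len₂ S → at₂ S i ≡ F → at₂ S (suc i) ≡ F → ⊥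
    repeats₂ {S} i< si< e e′ = 1+n≢n (sym (nthOr-injective dflt (cr₂-unique S) i< si< (trans e (sym e′))))

    no-3-reversalᵗ : ∀ {e d₁ d₂} → Step (e , true) d₁ → Step d₁ d₂ → Step d₂ (e , false) → ⊥
    no-3-reversalᵗ (F⁺₁ _ _ _) (B⁻₁ _ p r) (S⁺₁ q s _ _ _) = repeats₂ p q r s
    no-3-reversalᵗ (F⁺₁ q _ _) (B⁻₁ _ _ _) (S⁺mid _ p) = <-irrefl p q
    no-3-reversalᵗ (F⁺₂ _ _ _ q s) (S⁻₂ p r _) (B⁺₂ _ _ _) = repeats₂ p q r s
    no-3-reversalᵗ (S⁺₁ _ _ _ q s) (F⁻₁ p r _ _ _) (B⁺₁ _ _ _) = repeats₁ p q r s
    no-3-reversalᵗ (S⁺₂ _ _ _) (B⁻₂ _ p r) (F⁺₂ q s _ _ _) = repeats₁ p q r s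
    no-3-reversalᵗ (S⁺mid _ _) (F⁻₁ _ _ _ p q) (B⁺₁ _ _ _) = nocross p q
    no-3-reversalᵗ (B⁺₁ _ _ _) (S⁻₁ _ _ _ p r) (F⁺₁ q s _) = repeats₁ p q r s
    no-3-reversalᵗ (B⁺₂ _ q s) (F⁻₂ p r _ _ _ _ _) (S⁺₂ _ _ _) = repeats₁ p q r s

    no-3-reversalᶠ : ∀ {e d₁ d₂} → Step (e , false) d₁ → Step d₁ d₂ → Step d₂ (e , true) → ⊥
    no-3-reversalᶠ (F⁻₁ _ _ _ _ _) (B⁺₁ _ q s) (S⁻₁ p r _ _ _) = repeats₂ p q r s
    no-3-reversalᶠ (F⁻₂ _ _ _ _ _ p r) (S⁺₂ q s _) (B⁻₂ _ _ _) = repeats₂ p q r s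
    no-3-reversalᶠ (S⁻₁ _ _ _ p r) (F⁺₁ q s _) (B⁻₁ _ _ _) = repeats₁ p q r s
    no-3-reversalᶠ (S⁻₂ _ _ _) (B⁺₂ _ q s) (F⁻₂ p r _ _ _ _ _) = repeats₁ p q r s
    no-3-reversalᶠ (B⁻₁ _ p r) (S⁺₁ q s _ _ _) (F⁻₁ _ _ _ _ _) = repeats₂ p q r s
    no-3-reversalᶠ (B⁻₁ _ _ _) (S⁺mid _ _) (F⁻₁ _ _ _ p q) = nocross p q
    no-3-reversalᶠ (B⁻₂ _ p r) (F⁺₂ q s _ _ _) (S⁻₂ _ _ _) = repeats₁ p q r s

    no-3-reversal : ∀ {e b d₁ d₂} → Step (e , b) d₁ → Step d₁ d₂ → Step d₂ (e , not b) → ⊥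
    no-3-reversal {b = true}  = no-3-reversalᵗ
    no-3-reversal {b = false} = no-3-reversalᶠ

    no-short-return : ∀ {x} → Trail x → ∀ i k → 1 ≤ k → k ≤ 4 → proj₁ (x i) ≢ proj₁ (x (k + i))
    no-short-return tr i 0 () _
    no-short-return tr i 1 _ _ = changes-edge (tr i)
    no-short-return tr i 2 _ _ e =
      no-2-cycle (tr i) (subst (Step _) (cong₂ _,_ (sym e) (flips-twice (tr i) (tr (1 + i)))) (tr (1 + i)))
    no-short-return {x} tr i 3 _ _ e =
      no-3-reversal (tr i) (tr (1 + i)) (subst (Step _) same (tr (2 + i)))
      where
      same : x (3 + i) ≡ (proj₁ (x i) , not (proj₂ (x i)))
      same = cong₂ _,_ (sym e) (trans (flips (tr (2 + i))) (cong not (flips-twice (tr i) (tr (1 + i)))))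
    no-short-return {x} tr i 4 _ _ e =
      no-4-cycle (tr i) (tr (1 + i)) (tr (2 + i)) (subst (Step _) same (tr (3 + i)))
      where
      same : x (4 + i) ≡ x i
      same = cong₂ _,_ (sym e) (trans (flips-twice (tr (2 + i)) (tr (3 + i))) (flips-twice (tr i) (tr (1 + i))))
    no-short-return tr i (suc (suc (suc (suc (suc k))))) _ (s≤s (s≤s (s≤s (s≤s ()))))

    no-return-within-4 : ∀ {x} → Trail x → ∀ {i j} → i < j → j ≤ i + 4 → proj₁ (x i) ≢ proj₁ (x j)
    no-return-within-4 {x} tr {i} {j} i<j j≤ =
      subst (λ m → proj₁ (x i) ≢ proj₁ (x m)) (m∸n+n≡m (<⇒≤ i<j))
        (no-short-return tr i (j ∸ i) (m<n⇒0<n∸m i<j) (subst (j ∸ i ≤_) (m+n∸m≡n i 4) (∸-monoˡ-≤ i j≤)))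

module Interior (D : MDiagram) (wf : WellFormed D) where
  open Resolved D
  open FaceTracing D
  open WellFormed wf

  cr₁-crossing : ∀ {F S} → S ∈ cr₁ F → S ∈ seconds D × T (crossesᵇ F S)
  cr₁-crossing {F} S∈ = ∈-filter⁻ (T? ∘ crossesᵇ F) (∈-sortBy⁻ (xLessᵇ F) S∈)

  cr₂-crossing : ∀ {F S} → F ∈ cr₂ S → F ∈ firsts D × T (crossesᵇ F S)
  cr₂-crossing {S = S} F∈ = ∈-filter⁻ (T? ∘ λ F → crossesᵇ F S) (∈-sortBy⁻ (λ X Y → xLessᵇ S Y X) F∈)

  position₁ : ∀ {F S} → S ∈ seconds D → T (crossesᵇ F S)
            → indexOf S (cr₁ F) < len₁ F × at₁ F (indexOf S (cr₁ F)) ≡ S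
  position₁ {F} {S} S∈ t =
    indexOf-spec dflt S (cr₁ F) (∈-sortBy⁺ (xLessᵇ F) (∈-filter⁺ (T? ∘ crossesᵇ F) S∈ t))

  position₂ : ∀ {F S} → F ∈ firsts D → T (crossesᵇ F S)
            → indexOf F (cr₂ S) < len₂ S × at₂ S (indexOf F (cr₂ S)) ≡ F
  position₂ {F} {S} F∈ t =
    indexOf-spec dflt F (cr₂ S)
      (∈-sortBy⁺ (λ X Y → xLessᵇ S Y X) (∈-filter⁺ (T? ∘ λ F → crossesᵇ F S) F∈ t))

  cr₁-unique : ∀ F → Unique (cr₁ F)
  cr₁-unique F = Unique-sortBy (xLessᵇ F) (Unique.filter⁺ (T? ∘ crossesᵇ F) seconds-unique)

  cr₂-unique : ∀ S → Unique (cr₂ S)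
  cr₂-unique S =
    Unique-sortBy (λ X Y → xLessᵇ S Y X) (Unique.filter⁺ (T? ∘ λ F → crossesᵇ F S) firsts-unique)

  open DistinctCrossings cr₁-unique cr₂-unique using (no-return-within-4)

  firstInto-spec : ∀ c → (firstInto c ∈ firsts D × proj₂ (firstInto c) ≡ c) ⊎ firstInto c ≡ dflt
  firstInto-spec c with findOr-spec dflt (λ F → proj₂ F ≡ᵇ c) (firsts D)
  ... | inj₁ (F∈ , t) = inj₁ (F∈ , ≡ᵇ⇒≡ _ c t)
  ... | inj₂ eq       = inj₂ eq

  cr₁-dflt : cr₁ dflt ≡ []
  cr₁-dflt = cong (sortBy (xLessᵇ dflt)) (none (seconds D))
    where
    none : ∀ xs → filterᵇ (crossesᵇ dflt) xs ≡ []
    none []                 = refl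
    none ((zero  , _) ∷ xs) = none xs
    none ((suc _ , _) ∷ xs) = none xs

  head-at-end : ∀ {F k} → (k <ᵇ len₁ F) ≡ false → isMidᵇ (proj₂ F) ≡ false
              → head (piece₁ F k) ≡ bd (proj₂ F)
  head-at-end k≮ notMid rewrite k≮ | notMid = refl

  Proper : Dart → Set
  Proper (piece₁ F p , _) = F ∈ firsts D × p ≤ len₁ F
  Proper (piece₂ S p , _) = S ∈ seconds D × p ≤ len₂ S
  Proper (short j , _)    = ⊤
  Proper (bridge F S , _) = F ∈ firsts D × S ∈ seconds D × T (crossesᵇ F S)

  ProperEdge : Edge → Set
  ProperEdge e = ∀ b → Proper (e , b)

  darts-proper : All Proper darts
  darts-proper = concatMap-All (λ e → (e , true) ∷ (e , false) ∷ [])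
                   (λ e∈ → let pe = All.lookup edges-proper e∈ in pe true ∷ pe false ∷ [])
    where
    pieces₁ : All ProperEdge (concatMap (λ F → applyUpTo (piece₁ F) (suc (len₁ F))) (firsts D))
    pieces₁ = concatMap-All (λ F → applyUpTo (piece₁ F) (suc (len₁ F)))
                λ {F} F∈ → applyUpTo⁺₁ (piece₁ F) _ λ { (s≤s p≤) _ → F∈ , p≤ }
    pieces₂ : All ProperEdge (concatMap (λ S → applyUpTo (piece₂ S) (suc (len₂ S))) (seconds D))
    pieces₂ = concatMap-All (λ S → applyUpTo (piece₂ S) (suc (len₂ S)))
                λ {S} S∈ → applyUpTo⁺₁ (piece₂ S) _ λ { (s≤s p≤) _ → S∈ , p≤ }
    shorts : All ProperEdge (map (λ S → short (proj₁ S)) (seconds D))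
    shorts = map⁺ (All.tabulate λ _ _ → tt)
    bridges : All ProperEdge (concatMap (λ F → map (bridge F) (cr₁ F)) (firsts D))
    bridges = concatMap-All (λ F → map (bridge F) (cr₁ F))
                λ {F} F∈ → map⁺ {f = bridge F} (All.tabulate λ S∈ _ → F∈ , cr₁-crossing S∈)
    edges-proper : All ProperEdge edges
    edges-proper = ++⁺ pieces₁ (++⁺ pieces₂ (++⁺ shorts bridges))

  OffLine : Node → Set
  OffLine v = ¬ isBoundary v

  Advances : Dart → Set
  Advances d = OffLine (dtail (φ d)) → OffLine (dtail (φ (φ d))) → Step d (φ d) × Proper (φ d)

  ltᵇ : ∀ {m n} → (m <ᵇ n) ≡ true → m < n
  ltᵇ {m} {n} eq = <ᵇ⇒< m n (Equivalence.from T-≡ eq)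

  geᵇ : ∀ {m n} → (m <ᵇ n) ≡ false → n ≤ m
  geᵇ eq = ≮⇒≥ λ m<n → subst T eq (<⇒<ᵇ m<n)

  advance-F⁺ : ∀ {F} q → F ∈ firsts D → Advances (piece₁ F (suc q) , true)
  advance-F⁺ {F} q F∈ with suc q <ᵇ len₁ F in inRange
  ... | true with cr₁-crossing (nthOr-∈ dflt (cr₁ F) (ltᵇ inRange)) | proj₁ F <ᵇ proj₁ (at₁ F (suc q)) in case
  ...   | S∈ , t | true  = λ _ _ → F⁺₁ (ltᵇ inRange) refl (ltᵇ case) , F∈ , S∈ , t
  ...   | S∈ , t | false with position₂ F∈ t
  ...     | i< , at≡ = λ _ _ → F⁺₂ (ltᵇ inRange) refl (geᵇ case) i< at≡ , S∈ , <⇒≤ i<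
  advance-F⁺ {F} q F∈ | false with isMidᵇ (proj₂ F) in isMid
  ... | true  = λ _ off₂ → ⊥-elim (off₂ (_ , refl))
  ... | false = λ off₁ _ → ⊥-elim (off₁ (_ , head-at-end inRange isMid))

  advance-F⁻ : ∀ {F} j → F ∈ firsts D → j < len₁ F → Advances (piece₁ F (suc j) , false)
  advance-F⁻ {F} j F∈ j< with cr₁-crossing (nthOr-∈ dflt (cr₁ F) j<) | proj₁ F <ᵇ proj₁ (at₁ F j) in case
  ... | S∈ , t | true  = λ _ _ → F⁻₁ j< refl (ltᵇ case) (firsts-rightward F∈) t , F∈ , S∈ , t
  ... | S∈ , t | false with position₂ F∈ t
  ...   | i< , at≡ = λ _ _ → F⁻₂ j< refl (geᵇ case) (firsts-rightward F∈) t i< at≡ , S∈ , i<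

  advance-S⁺ : ∀ {S} q → S ∈ seconds D → suc q ≤ len₂ S → Advances (piece₂ S (suc q) , true)
  advance-S⁺ {S} q S∈ q< with suc q <ᵇ len₂ S in inRange
  ... | true with cr₂-crossing (nthOr-∈ dflt (cr₂ S) (ltᵇ inRange)) | proj₁ (at₂ S (suc q)) <ᵇ proj₁ S in case
  ...   | F∈ , t | true with position₁ S∈ t
  ...     | j< , at≡ = λ _ _ → S⁺₁ (ltᵇ inRange) refl (ltᵇ case) j< at≡ , F∈ , <⇒≤ j<
  advance-S⁺ {S} q S∈ q< | true | F∈ , t | false = λ _ _ → S⁺₂ (ltᵇ inRange) refl (geᵇ case) , F∈ , S∈ , t
  advance-S⁺ {c , d} q S∈ q< | false with firstInto c | firstInto-spec c
  ... | (a , b) | inj₁ (F∈ , refl) = λ _ _ → S⁺mid (≤-antisym q< (geᵇ inRange)) refl , F∈ , ≤-refl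
  ... | _       | inj₂ refl        =
    λ _ off₂ → ⊥-elim (off₂ (_ , cong (λ L → dtail (σ (piece₁ dflt (length L) , true))) cr₁-dflt))

  advance-S⁻ : ∀ {S} i → S ∈ seconds D → i < len₂ S → Advances (piece₂ S (suc i) , false)
  advance-S⁻ {S} i S∈ i< with cr₂-crossing (nthOr-∈ dflt (cr₂ S) i<) | proj₁ (at₂ S i) <ᵇ proj₁ S in case
  ... | F∈ , t | true with position₁ S∈ t
  ...   | j< , at≡ = λ _ _ → S⁻₁ i< refl (ltᵇ case) j< at≡ , F∈ , j<
  advance-S⁻ {S} i S∈ i< | F∈ , t | false = λ _ _ → S⁻₂ i< refl (geᵇ case) , F∈ , S∈ , t

  advance-B⁺ : ∀ {F S} → F ∈ firsts D → S ∈ seconds D → T (crossesᵇ F S) → Advances (bridge F S , true)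
  advance-B⁺ {F} {S} F∈ S∈ t with proj₁ F <ᵇ proj₁ S in case | position₁ S∈ t | position₂ F∈ t
  ... | true  | _        | i< , at≡ = λ _ _ → B⁺₁ (ltᵇ case) i< at≡ , S∈ , <⇒≤ i<
  ... | false | j< , at≡ | _        = λ _ _ → B⁺₂ (geᵇ case) j< at≡ , F∈ , <⇒≤ j<

  advance-B⁻ : ∀ {F S} → F ∈ firsts D → S ∈ seconds D → T (crossesᵇ F S) → Advances (bridge F S , false)
  advance-B⁻ {F} {S} F∈ S∈ t with proj₁ F <ᵇ proj₁ S in case | position₁ S∈ t | position₂ F∈ t
  ... | true  | _        | i< , at≡ = λ _ _ → B⁻₁ (ltᵇ case) i< at≡ , S∈ , i<
  ... | false | j< , at≡ | _        = λ _ _ → B⁻₂ (geᵇ case) j< at≡ , F∈ , j<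

  -- Darts starting on ℓ, or returning to ℓ within one step, are excluded by
  -- the hypotheses; every other proper dart advances by a Step.
  advance : ∀ d → Proper d → OffLine (dtail d) → Advances d
  advance (piece₁ F zero , true)     _          off₀ = ⊥-elim (off₀ (_ , refl))
  advance (piece₁ F (suc q) , true)  (F∈ , _)   _    = advance-F⁺ q F∈
  advance (piece₁ F zero , false)    _          _    = λ off₁ _ → ⊥-elim (off₁ (_ , refl))
  advance (piece₁ F (suc j) , false) (F∈ , j<)  _    = advance-F⁻ j F∈ j<
  advance (piece₂ S zero , true)     _          off₀ = ⊥-elim (off₀ (_ , refl))
  advance (piece₂ S (suc q) , true)  (S∈ , q<)  _    = advance-S⁺ q S∈ q<
  advance (piece₂ S zero , false)    _          _    = λ off₁ _ → ⊥-elim (off₁ (_ , refl))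
  advance (piece₂ S (suc i) , false) (S∈ , i<)  _    = advance-S⁻ i S∈ i<
  advance (short j , true)           _          off₀ = ⊥-elim (off₀ (_ , refl))
  advance (short j , false)          _          _    = λ off₁ _ → ⊥-elim (off₁ (_ , refl))
  advance (bridge F S , true)  (F∈ , S∈ , t) _ = advance-B⁺ F∈ S∈ t
  advance (bridge F S , false) (F∈ , S∈ , t) _ = advance-B⁻ F∈ S∈ t

  face-trail : ∀ {d n} → IsFace d n → Interior d n → Trail (λ k → iter k d)
  face-trail {d} {n} face interior k = proj₁ (advance (iter k d) (proper k) (off k) (off (1 + k)) (off (2 + k)))
    where
    open IsFace face
    instance
      n≢0 : NonZero n
      n≢0 = >-nonZero pos
    off : ∀ k → OffLine (dtail (iter k d))
    off k = subst (OffLine ∘ dtail) (sym (iter-mod closes k)) (interior (k % n) (m%n<n k n))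
    proper : ∀ k → Proper (iter k d)
    proper zero    = All.lookup darts-proper inGraph
    proper (suc k) = proj₂ (advance (iter k d) (proper k) (off k) (off (1 + k)) (off (2 + k)))

  -- An interior face of length at most 4 would repeat its first edge within
  -- four steps; a longer one has five distinct edges among its first five darts.
  no-interior-square : ¬ HasInteriorSquare
  no-interior-square (d , n , face , interior , es , four , _ , onFace) = case n ≤? 4 of λ where
      (yes n≤4) → no-return-within-4 trail (IsFace.pos face) n≤4 (cong proj₁ (sym (IsFace.closes face)))
      (no n≰4)  → let (i , j , i<j , j≤ , same) = pigeonhole-∈ es edge (onEs (≰⇒> n≰4))
                  in no-return-within-4 trail i<j (≤-trans (subst (j ≤_) four j≤) (m≤n+m 4 i)) same
    where
    trail : Trail (λ k → iter k d)
    trail = face-trail face interior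
    edge : ℕ → Edge
    edge k = proj₁ (iter k d)
    onEs : 4 < n → ∀ k → k ≤ length es → edge k ∈ es
    onEs 4<n k k≤ = Equivalence.from (onFace _) (k , ≤-<-trans (subst (k ≤_) four k≤) 4<n , refl)

lemma3p5 : (r₁ r₂ r₃ : List ℕ) → IsSYT3 r₁ r₂ r₃ → ¬ resolvedHasInteriorSquare r₁ r₂ r₃
lemma3p5 r₁ r₂ r₃ _ = Interior.no-interior-square (mDiagram r₁ r₂ r₃) (mDiagram-wellFormed r₁ r₂ r₃)
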